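{- Let $G=(V,E)$ be a simple graph, either directed or undirected, that is minimally $k$-$st$-edge-connected. Then $|E|\le \sqrt{2k}\cdot |V|$.
   Context: For nodes $s,t\in V$ and a positive integer $k$, $G$ is minimally $k$-$st$-edge-connected if $G$ contains $k$ pairwise edge-disjoint $st$-paths (directed from $s$ to $t$ in the directed case) but no proper subgraph of $G$ contains $k$ pairwise edge-disjoint $st$-paths. -}

module Defs where

open import Data.Nat using (ℕ; zero; suc; _+_; _*_; _≤_)
open import Data.Bool using (Bool; true; false)
open import Data.Fin using (Fin) renaming (_<_ to _<ᶠ_)
open import Data.Fin.Properties using () renaming (_<?_ to _<ᶠ?_)
open import Data.List using (List; []; _∷_; map; allFin)
open import Data.Nat.ListAction using (sum)
open import Data.List.Relation.Unary.All using (All)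
open import Data.List.Relation.Unary.Unique.Propositional using (Unique)
open import Data.List.Membership.Propositional using (_∈_)
open import Data.Product using (Σ; _×_; _,_; ∃-syntax)
open import Data.Sum using (_⊎_)
open import Relation.Binary.PropositionalEquality using (_≡_; _≢_)
open import Relation.Nullary using (¬_)

data Kind : Set where
  directed undirected : Kind

-- Simple: no loops; no parallel edges (automatic for an
-- adjacency relation).  Undirected graphs have a symmetric relation,
-- and the undirected edge {u,v} is present iff adj u v ≡ true.
record SimpleGraph (κ : Kind) (n : ℕ) : Set where
  field
    adj      : Fin n → Fin n → Bool
    loopless : ∀ v → adj v v ≡ false
    symm     : κ ≡ undirected → ∀ u v → adj u v ≡ adj v u
open SimpleGraph public

-- Number of edges |E|.
-- Directed: number of ordered pairs (u,v) with an arc u → v.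
-- Undirected: number of pairs u < v with an edge {u,v}.
countTrue : {A : Set} → (A → Bool) → List A → ℕ
countTrue p []       = 0
countTrue p (x ∷ xs) with p x
... | true  = suc (countTrue p xs)
... | false = countTrue p xs

below : {n : ℕ} → Fin n → Fin n → Bool
below u v with u <ᶠ? v
... | Relation.Nullary.yes _ = true
... | Relation.Nullary.no  _ = false

edgeIndicator : (κ : Kind) {n : ℕ} → (Fin n → Fin n → Bool) → Fin n → Fin n → Bool
edgeIndicator directed   a u v = a u v
edgeIndicator undirected a u v with below u v
... | true  = a u v
... | false = false

numEdges : {κ : Kind} {n : ℕ} → SimpleGraph κ n → ℕ
numEdges {κ} {n} G =
  sum (map (λ u → countTrue (edgeIndicator κ (adj G) u) (allFin n)) (allFin n))

data Walk {n : ℕ} (F : Fin n → Fin n → Bool) : Fin n → Fin n → Set where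
  here : (v : Fin n) → Walk F v v
  step : {u w v : Fin n} → F u w ≡ true → Walk F w v → Walk F u v

vertices : {n : ℕ} {F : Fin n → Fin n → Bool} {u v : Fin n} → Walk F u v → List (Fin n)
vertices (here v)            = v ∷ []
vertices (step {u = u} _ p)  = u ∷ vertices p

edges : {n : ℕ} {F : Fin n → Fin n → Bool} {u v : Fin n} → Walk F u v → List (Fin n × Fin n)
edges (here v)                       = []
edges (step {u = u} {w = w} _ p)     = (u , w) ∷ edges p

record Path {n : ℕ} (W : Fin n → Bool) (F : Fin n → Fin n → Bool) (s t : Fin n) : Set where
  field
    walk     : Walk F s t
    distinct : Unique (vertices walk)
    inside   : All (λ v → W v ≡ true) (vertices walk)
open Path public

SameEdge : {n : ℕ} → Kind → Fin n × Fin n → Fin n × Fin n → Set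
SameEdge directed   (u , v) (u' , v') = u ≡ u' × v ≡ v'
SameEdge undirected (u , v) (u' , v') = (u ≡ u' × v ≡ v') ⊎ (u ≡ v' × v ≡ u')

EdgeDisjoint : {n : ℕ} → Kind → List (Fin n × Fin n) → List (Fin n × Fin n) → Set
EdgeDisjoint κ es fs = ∀ {e f} → e ∈ es → f ∈ fs → ¬ SameEdge κ e f

HasDisjointPaths : (κ : Kind) {n : ℕ} → (Fin n → Bool) → (Fin n → Fin n → Bool)
                   → Fin n → Fin n → ℕ → Set
HasDisjointPaths κ W F s t k =
  Σ (Fin k → Path W F s t) λ P →
    ∀ i j → i ≢ j → EdgeDisjoint κ (edges (walk (P i))) (edges (walk (P j)))

record Subgraph {κ : Kind} {n : ℕ} (G : SimpleGraph κ n) : Set where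
  field
    W       : Fin n → Bool
    F       : Fin n → Fin n → Bool
    F⊆E     : ∀ u v → F u v ≡ true → adj G u v ≡ true
    F⊆W×W   : ∀ u v → F u v ≡ true → W u ≡ true × W v ≡ true
    Fsymm   : κ ≡ undirected → ∀ u v → F u v ≡ F v u
open Subgraph public

Proper : {κ : Kind} {n : ℕ} {G : SimpleGraph κ n} → Subgraph G → Set
Proper {n = n} {G} H =
  (∃[ v ] W H v ≡ false) ⊎ (∃[ u ] ∃[ v ] (adj G u v ≡ true × F H u v ≡ false))

MinimallyEdgeConnected : {κ : Kind} {n : ℕ} → SimpleGraph κ n → Fin n → Fin n → ℕ → Set
MinimallyEdgeConnected {κ} G s t k =
  HasDisjointPaths κ (λ _ → true) (adj G) s t k ×
  (∀ (H : Subgraph G) → Proper H → ¬ HasDisjointPaths κ (W H) (F H) s t k)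

-- Fix k edge-disjoint st-paths in G and let D be the digraph of their edges, each oriented as its path
-- traverses it. D is an st-flow of value k, and every such flow splits into k arc-disjoint simple st-paths.
-- Hence, by minimality, G is exactly the underlying graph of D, and D is acyclic: deleting a directed cycle
-- would leave a flow of value k, i.e. k disjoint paths avoiding an edge of G. Number the vertices
-- topologically by pos : V → {0, …, n−1}. Every arc u → v gets the length pos v − pos u ≥ 1; as pos is
-- injective, at most n arcs have any given length, and the lengths add up to k (pos t − pos s) ≤ k n.
-- Dropping the arcs of length 1 (at most n of them) and shortening the others by one, induction shows that
-- m such lengths with total S satisfy m² ≤ 2 n S, whence |E|² ≤ 2 k n².
module Submission where

open import Defs

open import Data.Bool using (Bool; true; false; _∧_; _∨_; not; T)
open import Data.Bool.Properties using (¬-not; ∨-comm; ∧-zeroʳ) renaming (_≟_ to _≟ᵇ_)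
open import Data.Empty using (⊥; ⊥-elim)
open import Data.Fin using (Fin; zero; suc)
open import Data.Fin.Properties using (any?; toℕ-injective) renaming (_≟_ to _≟ᶠ_; _<?_ to _<ᶠ?_)
open import Data.List using (List; []; _∷_; map; length; tabulate; allFin)
open import Data.List.Membership.Propositional using (_∈_; _∉_)
open import Data.List.Membership.Propositional.Properties using (∈-map⁺)
open import Data.List.Relation.Unary.All as All using ([])
open import Data.List.Relation.Unary.All.Properties using (anti-mono; ¬Any⇒All¬)
open import Data.List.Relation.Unary.Any using (here; there)
open import Data.List.Relation.Unary.Unique.Propositional using (Unique; []; _∷_)
open import Data.List.Relation.Unary.Unique.Propositional.Properties using (Unique[x∷xs]⇒x∉xs; map⁻)
open import Data.Nat using (ℕ; zero; suc; _+_; _*_; _∸_; _≡ᵇ_; _≤_; _<_; z≤n; s≤s)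
open import Data.Nat.ListAction using (sum)
open import Data.Nat.Properties
open import Data.Nat.Tactic.RingSolver using (solve-∀)
open import Data.Product using (_×_; _,_; proj₁; proj₂; ∃-syntax)
open import Data.Sum using (_⊎_; inj₁; inj₂)
open import Data.Unit using (tt)
open import Function using (_∘_; id; case_of_)
open import Relation.Binary.Definitions using (DecidableEquality)
open import Relation.Binary.PropositionalEquality
open import Relation.Nullary using (Dec; yes; no; does; _×-dec_; ¬_)
open import Relation.Nullary.Decidable using (dec-true; dec-false; map′)

open import Algebra.Properties.Semiring.Sum +-*-semiring
  using (sum-syntax; sum-cong-≗; ∑-distrib-+; ∑-comm; *-distribˡ-sum)

χ : Bool → ℕ
χ true  = 1
χ false = 0

χ≤1 : ∀ b → χ b ≤ 1
χ≤1 true  = s≤s z≤n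
χ≤1 false = z≤n

χ-∧ : ∀ a b → χ (a ∧ b) ≡ χ a * χ b
χ-∧ true  b = sym (+-identityʳ (χ b))
χ-∧ false b = refl

χ-∖ : ∀ d e → (e ≡ true → d ≡ true) → χ (d ∧ not e) + χ e ≡ χ d
χ-∖ true  false _   = refl
χ-∖ false false _   = refl
χ-∖ true  true  _   = refl
χ-∖ false true  e⇒d = case e⇒d refl of λ ()

χ-∨ : ∀ a b → (a ≡ true → b ≡ true → ⊥) → χ (a ∨ b) ≡ χ a + χ b
χ-∨ true  true  both = ⊥-elim (both refl refl)
χ-∨ true  false _    = refl
χ-∨ false b     _    = refl

δ : ∀ {n} → Fin n → Fin n → ℕ
δ a i = χ (does (i ≟ᶠ a))

δ-self : ∀ {n} (a : Fin n) → δ a a ≡ 1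
δ-self a = cong χ (dec-true (a ≟ᶠ a) refl)

δ-other : ∀ {n} {a i : Fin n} → i ≢ a → δ a i ≡ 0
δ-other {a = a} {i} i≢a = cong χ (dec-false (i ≟ᶠ a) i≢a)

∑-const : ∀ n c → ∑[ i < n ] c ≡ n * c
∑-const zero    c = refl
∑-const (suc n) c = cong (c +_) (∑-const n c)

∑-zero : ∀ n → ∑[ i < n ] 0 ≡ 0
∑-zero n = trans (∑-const n 0) (*-zeroʳ n)

∑-mono-≤ : ∀ {n} {f g : Fin n → ℕ} → (∀ i → f i ≤ g i) → ∑[ i < n ] f i ≤ ∑[ i < n ] g i
∑-mono-≤ {zero}  f≤g = z≤n
∑-mono-≤ {suc n} f≤g = +-mono-≤ (f≤g zero) (∑-mono-≤ (f≤g ∘ suc))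

≤-∑ : ∀ {n} (f : Fin n → ℕ) i → f i ≤ ∑[ j < n ] f j
≤-∑ f zero    = m≤m+n _ _
≤-∑ f (suc i) = ≤-trans (≤-∑ (f ∘ suc) i) (m≤n+m _ (f zero))

∑-δ-* : ∀ {n} (a : Fin n) (f : Fin n → ℕ) → ∑[ i < n ] (δ a i * f i) ≡ f a
∑-δ-* {suc n} zero    f = trans (cong (f zero + 0 +_) (∑-zero n)) (trans (+-identityʳ _) (+-identityʳ _))
∑-δ-* {suc n} (suc a) f = ∑-δ-* a (f ∘ suc)

∑-δ : ∀ {n} (a : Fin n) → ∑[ i < n ] δ a i ≡ 1
∑-δ a = trans (sum-cong-≗ (λ i → sym (*-identityʳ (δ a i)))) (∑-δ-* a (λ _ → 1))

module _ {n : ℕ} {p : Fin n → Bool} where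

  ∑-χ-none : (∀ i → p i ≡ false) → ∑[ i < n ] χ (p i) ≡ 0
  ∑-χ-none none = trans (sum-cong-≗ (cong χ ∘ none)) (∑-zero n)

  ∑-χ-unique : ∀ {i} → p i ≡ true → (∀ j → p j ≡ true → j ≡ i) → ∑[ j < n ] χ (p j) ≡ 1
  ∑-χ-unique {i} pi uniq = trans (sum-cong-≗ χp≗δ) (∑-δ i)
    where
    χp≗δ : ∀ j → χ (p j) ≡ δ i j
    χp≗δ j with j ≟ᶠ i | p j in pj
    ... | yes refl | true  = refl
    ... | yes refl | false = case trans (sym pi) pj of λ ()
    ... | no j≢i   | true  = ⊥-elim (j≢i (uniq j pj))
    ... | no _     | false = refl

  ∑-χ-≤1 : (∀ i j → p i ≡ true → p j ≡ true → i ≡ j) → ∑[ i < n ] χ (p i) ≤ 1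
  ∑-χ-≤1 uniq with any? (λ i → p i ≟ᵇ true)
  ... | yes (i , pi) = ≤-reflexive (∑-χ-unique pi (λ j pj → uniq j i pj pi))
  ... | no none      = ≤-trans (≤-reflexive (∑-χ-none (λ i → ¬-not (λ pi → none (i , pi))))) z≤n

witness : ∀ {A : Set} (a? : Dec A) → does a? ≡ true → A
witness (yes a) _ = a

∑-χ-any : ∀ {n} {P : Fin n → Set} (P? : ∀ i → Dec (P i)) → (∀ i j → P i → P j → i ≡ j) →
          χ (does (any? P?)) ≡ ∑[ i < n ] χ (does (P? i))
∑-χ-any P? uniq with any? P?
... | yes (i , pi) = sym (∑-χ-unique (dec-true (P? i) pi) (λ j pj → uniq j i (witness (P? j) pj) pi))
... | no none      = sym (∑-χ-none (λ i → dec-false (P? i) (λ pi → none (i , pi))))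

module _ {A : Set} (_≟_ : DecidableEquality A) where
  open import Data.List.Membership.DecPropositional _≟_ using (_∈?_)

  χ-∈?-∷ : ∀ z {e es} → e ∉ es → χ (does (z ∈? (e ∷ es))) ≡ χ (does (z ≟ e)) + χ (does (z ∈? es))
  χ-∈?-∷ z {e} {es} e∉es with z ≟ e
  ... | yes refl = cong (λ b → suc (χ b)) (sym (dec-false (z ∈? es) e∉es))
  ... | no _     = refl

module _ {n : ℕ} where
  open import Data.List.Membership.DecPropositional (_≟ᶠ_ {n}) using (_∈?_)

  unique-length : {xs : List (Fin n)} → Unique xs → length xs ≤ n
  unique-length {xs} uniq = begin
    length xs                  ≡⟨ count uniq ⟨
    ∑[ y < n ] χ (does (y ∈? xs)) ≤⟨ ∑-mono-≤ (λ y → χ≤1 (does (y ∈? xs))) ⟩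
    ∑[ y < n ] 1               ≡⟨ ∑-const n 1 ⟩
    n * 1                      ≡⟨ *-identityʳ n ⟩
    n                          ∎
    where
    open ≤-Reasoning
    count : ∀ {xs} → Unique xs → ∑[ y < n ] χ (does (y ∈? xs)) ≡ length xs
    count {[]}     []           = ∑-zero n
    count {a ∷ xs} uniq@(_ ∷ u) = begin-equality
      ∑[ y < n ] χ (does (y ∈? (a ∷ xs)))
        ≡⟨ sum-cong-≗ (λ y → χ-∈?-∷ _≟ᶠ_ y (Unique[x∷xs]⇒x∉xs uniq)) ⟩
      ∑[ y < n ] (δ a y + χ (does (y ∈? xs)))       ≡⟨ ∑-distrib-+ (δ a) _ ⟩
      ∑[ y < n ] δ a y + ∑[ y < n ] χ (does (y ∈? xs)) ≡⟨ cong₂ _+_ (∑-δ a) (count u) ⟩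
      suc (length xs)                              ∎

Digraph : ℕ → Set
Digraph n = Fin n → Fin n → Bool

Arc : ℕ → Set
Arc n = Fin n × Fin n

module _ {n : ℕ} where

  infix 4 _⊆ᵈ_
  _⊆ᵈ_ : Digraph n → Digraph n → Set
  D ⊆ᵈ E = ∀ {u v} → D u v ≡ true → E u v ≡ true

  outDeg inDeg : Digraph n → Fin n → ℕ
  outDeg D x = ∑[ y < n ] χ (D x y)
  inDeg  D x = ∑[ y < n ] χ (D y x)

  arcCount : Digraph n → ℕ
  arcCount D = ∑[ x < n ] outDeg D x

  outDeg-pos : ∀ {D u v} → D u v ≡ true → 1 ≤ outDeg D u
  outDeg-pos {D} {u} {v} uv = ≤-trans (≤-reflexive (cong χ (sym uv))) (≤-∑ (χ ∘ D u) v)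

  arcCount-pos : ∀ {D u v} → D u v ≡ true → 1 ≤ arcCount D
  arcCount-pos {D} {u} uv = ≤-trans (outDeg-pos {D = D} uv) (≤-∑ (outDeg D) u)

  infixl 6 _∖_
  _∖_ : Digraph n → Digraph n → Digraph n
  (D ∖ E) u v = D u v ∧ not (E u v)

  ∖-⊆ : ∀ {D E} → D ∖ E ⊆ᵈ D
  ∖-⊆ {D} {E} {u} {v} uv with D u v
  ... | true = refl

  ∖-removes : ∀ {D E u v} → E u v ≡ true → (D ∖ E) u v ≡ false
  ∖-removes {D} {E} {u} {v} uv rewrite uv = ∧-zeroʳ (D u v)

  ∖-excludes : ∀ {D E u v} → (D ∖ E) u v ≡ true → E u v ≡ false
  ∖-excludes {D} {E} {u} {v} uv with D u v | E u v
  ... | true | false = refl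

  module _ {D E : Digraph n} (E⊆D : E ⊆ᵈ D) where

    outDeg-∖ : ∀ x → outDeg (D ∖ E) x + outDeg E x ≡ outDeg D x
    outDeg-∖ x = trans (sym (∑-distrib-+ (λ y → χ ((D ∖ E) x y)) _))
                       (sum-cong-≗ (λ y → χ-∖ (D x y) (E x y) E⊆D))

    inDeg-∖ : ∀ x → inDeg (D ∖ E) x + inDeg E x ≡ inDeg D x
    inDeg-∖ x = trans (sym (∑-distrib-+ (λ y → χ ((D ∖ E) y x)) _))
                      (sum-cong-≗ (λ y → χ-∖ (D y x) (E y x) E⊆D))

    arcCount-∖-< : ∀ {u v} → E u v ≡ true → arcCount (D ∖ E) < arcCount D
    arcCount-∖-< uv = begin-strict
      arcCount (D ∖ E)                 <⟨ m<m+n _ (arcCount-pos uv) ⟩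
      arcCount (D ∖ E) + arcCount E    ≡⟨ ∑-distrib-+ (outDeg (D ∖ E)) _ ⟨
      ∑[ x < n ] (outDeg (D ∖ E) x + outDeg E x) ≡⟨ sum-cong-≗ outDeg-∖ ⟩
      arcCount D                       ∎
      where open ≤-Reasoning

    fewer-arcs : ∀ {m u v} → arcCount D < suc m → E u v ≡ true → arcCount (D ∖ E) < m
    fewer-arcs size uv = <-≤-trans (arcCount-∖-< uv) (≤-pred size)

module _ {n : ℕ} where

  -- Not Data.Product.Properties.≡-dec: here does ((x , y) ≟ₐ (u , v)) computes to does (x ≟ᶠ u) ∧ does (y ≟ᶠ v).
  _≟ₐ_ : DecidableEquality (Arc n)
  (u , v) ≟ₐ (u′ , v′) =
    map′ (λ (p , q) → cong₂ _,_ p q) (λ eq → cong proj₁ eq , cong proj₂ eq) ((u ≟ᶠ u′) ×-dec (v ≟ᶠ v′))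

  open import Data.List.Membership.DecPropositional _≟ₐ_ using (_∈?_)

  arcsOf : List (Arc n) → Digraph n
  arcsOf es u v = does ((u , v) ∈? es)

  ∈-arcsOf : ∀ {es u v} → arcsOf es u v ≡ true → (u , v) ∈ es
  ∈-arcsOf {es} {u} {v} = witness ((u , v) ∈? es)

  arcsOf-∈ : ∀ {es u v} → (u , v) ∈ es → arcsOf es u v ≡ true
  arcsOf-∈ {es} {u} {v} = dec-true ((u , v) ∈? es)

  module _ {u w : Fin n} {es : List (Arc n)} (uw∉es : (u , w) ∉ es) where

    outDeg-arcsOf-∷ : ∀ x → outDeg (arcsOf ((u , w) ∷ es)) x ≡ δ u x + outDeg (arcsOf es) x
    outDeg-arcsOf-∷ x = begin
      ∑[ y < n ] χ (does ((x , y) ∈? ((u , w) ∷ es)))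
        ≡⟨ sum-cong-≗ (λ y → χ-∈?-∷ _≟ₐ_ (x , y) uw∉es) ⟩
      ∑[ y < n ] (χ (does ((x , y) ≟ₐ (u , w))) + χ (arcsOf es x y))
        ≡⟨ ∑-distrib-+ (λ y → χ (does ((x , y) ≟ₐ (u , w)))) _ ⟩
      ∑[ y < n ] χ (does ((x , y) ≟ₐ (u , w))) + outDeg (arcsOf es) x
        ≡⟨ cong (_+ outDeg (arcsOf es) x)
                (sum-cong-≗ (λ y → trans (χ-∧ (does (x ≟ᶠ u)) _) (*-comm (δ u x) (δ w y)))) ⟩
      ∑[ y < n ] (δ w y * δ u x) + outDeg (arcsOf es) x
        ≡⟨ cong (_+ outDeg (arcsOf es) x) (∑-δ-* w (λ _ → δ u x)) ⟩
      δ u x + outDeg (arcsOf es) x ∎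
      where open ≡-Reasoning

    inDeg-arcsOf-∷ : ∀ x → inDeg (arcsOf ((u , w) ∷ es)) x ≡ δ w x + inDeg (arcsOf es) x
    inDeg-arcsOf-∷ x = begin
      ∑[ y < n ] χ (does ((y , x) ∈? ((u , w) ∷ es)))
        ≡⟨ sum-cong-≗ (λ y → χ-∈?-∷ _≟ₐ_ (y , x) uw∉es) ⟩
      ∑[ y < n ] (χ (does ((y , x) ≟ₐ (u , w))) + χ (arcsOf es y x))
        ≡⟨ ∑-distrib-+ (λ y → χ (does ((y , x) ≟ₐ (u , w)))) _ ⟩
      ∑[ y < n ] χ (does ((y , x) ≟ₐ (u , w))) + inDeg (arcsOf es) x
        ≡⟨ cong (_+ inDeg (arcsOf es) x) (sum-cong-≗ (λ y → χ-∧ (does (y ≟ᶠ u)) (does (x ≟ᶠ w)))) ⟩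
      ∑[ y < n ] (δ u y * δ w x) + inDeg (arcsOf es) x
        ≡⟨ cong (_+ inDeg (arcsOf es) x) (∑-δ-* u (λ _ → δ w x)) ⟩
      δ w x + inDeg (arcsOf es) x ∎
      where open ≡-Reasoning

module _ {n : ℕ} {R : Digraph n} where

  vertices-edges : ∀ {s t} (p : Walk R s t) → vertices p ≡ s ∷ map proj₂ (edges p)
  vertices-edges (here v)   = refl
  vertices-edges (step _ p) = cong (_ ∷_) (vertices-edges p)

  start∈vertices : ∀ {s t} (p : Walk R s t) → s ∈ vertices p
  start∈vertices p = subst (_ ∈_) (sym (vertices-edges p)) (here refl)

  head∈vertices : ∀ {s t u v} (p : Walk R s t) → (u , v) ∈ edges p → v ∈ vertices p
  head∈vertices p uv = subst (_ ∈_) (sym (vertices-edges p)) (there (∈-map⁺ proj₂ uv))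

  ∈-edges⇒arc : ∀ {s t u v} (p : Walk R s t) → (u , v) ∈ edges p → R u v ≡ true
  ∈-edges⇒arc (step e _) (here refl) = e
  ∈-edges⇒arc (step _ p) (there uv)  = ∈-edges⇒arc p uv

  arcsOf-edges-⊆ : ∀ {s t} (p : Walk R s t) → arcsOf (edges p) ⊆ᵈ R
  arcsOf-edges-⊆ p = ∈-edges⇒arc p ∘ ∈-arcsOf

  unique-edges : ∀ {s t} (p : Walk R s t) → Unique (vertices p) → Unique (edges p)
  unique-edges p up with subst Unique (vertices-edges p) up
  ... | _ ∷ heads-unique = map⁻ heads-unique

  unique-edges-cycle : ∀ {v w} (e : R w v ≡ true) (q : Walk R v w) →
                       Unique (vertices q) → Unique (edges (step e q))
  unique-edges-cycle e q uq = map⁻ (subst Unique (vertices-edges q) uq)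

  walk-balance : ∀ {s t} (p : Walk R s t) → Unique (edges p) → ∀ x →
    outDeg (arcsOf (edges p)) x + δ t x ≡ inDeg (arcsOf (edges p)) x + δ s x
  walk-balance (here v) _ x = refl
  walk-balance (step {u = u} {w = w} {v = t} e p) uniq@(_ ∷ up) x = begin
    outDeg (arcsOf (edges (step e p))) x + δ t x ≡⟨ cong (_+ δ t x) (outDeg-arcsOf-∷ uw∉ x) ⟩
    δ u x + outDeg (arcsOf (edges p)) x + δ t x  ≡⟨ +-assoc (δ u x) _ _ ⟩
    δ u x + (outDeg (arcsOf (edges p)) x + δ t x) ≡⟨ cong (δ u x +_) (walk-balance p up x) ⟩
    δ u x + (inDeg (arcsOf (edges p)) x + δ w x)  ≡⟨ +-comm (δ u x) _ ⟩
    inDeg (arcsOf (edges p)) x + δ w x + δ u x    ≡⟨ cong (_+ δ u x) (+-comm _ (δ w x)) ⟩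
    δ w x + inDeg (arcsOf (edges p)) x + δ u x    ≡⟨ cong (_+ δ u x) (inDeg-arcsOf-∷ uw∉ x) ⟨
    inDeg (arcsOf (edges (step e p))) x + δ u x   ∎
    where
    open ≡-Reasoning
    uw∉ = Unique[x∷xs]⇒x∉xs uniq

  no-antiparallel : ∀ {s t u v} (p : Walk R s t) → Unique (vertices p) →
                    (u , v) ∈ edges p → (v , u) ∈ edges p → ⊥
  no-antiparallel (step _ p) (s∉p ∷ _) (here refl) (here eq) =
    All.lookup s∉p (subst (_∈ vertices p) (cong proj₁ eq) (start∈vertices p)) refl
  no-antiparallel (step _ p) (s∉p ∷ _) (here refl) (there vu) = All.lookup s∉p (head∈vertices p vu) refl
  no-antiparallel (step _ p) (s∉p ∷ _) (there uv) (here refl) = All.lookup s∉p (head∈vertices p uv) refl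
  no-antiparallel (step _ p) (_ ∷ up) (there uv) (there vu)   = no-antiparallel p up uv vu

module _ {n : ℕ} {R R′ : Digraph n} (R⊆R′ : R ⊆ᵈ R′) where

  mapWalk : ∀ {s t} → Walk R s t → Walk R′ s t
  mapWalk (here v)   = here v
  mapWalk (step e p) = step (R⊆R′ e) (mapWalk p)

  vertices-mapWalk : ∀ {s t} (p : Walk R s t) → vertices (mapWalk p) ≡ vertices p
  vertices-mapWalk (here v)   = refl
  vertices-mapWalk (step _ p) = cong (_ ∷_) (vertices-mapWalk p)

  edges-mapWalk : ∀ {s t} (p : Walk R s t) → edges (mapWalk p) ≡ edges p
  edges-mapWalk (here v)   = refl
  edges-mapWalk (step _ p) = cong (_ ∷_) (edges-mapWalk p)

module _ {n : ℕ} {R : Digraph n} where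

  prefix : ∀ {y x w} (p : Walk R y x) → w ∈ vertices p → Walk R y w
  prefix (here _)   (here refl) = here _
  prefix (step _ _) (here refl) = here _
  prefix (step e p) (there w∈p) = step e (prefix p w∈p)

  prefix-⊆ : ∀ {y x w} (p : Walk R y x) (w∈p : w ∈ vertices p) {v} →
             v ∈ vertices (prefix p w∈p) → v ∈ vertices p
  prefix-⊆ (here _)   (here refl) v∈         = v∈
  prefix-⊆ (step _ _) (here refl) (here refl) = here refl
  prefix-⊆ (step _ p) (there _)   (here refl) = here refl
  prefix-⊆ (step _ p) (there w∈p) (there v∈)  = there (prefix-⊆ p w∈p v∈)

  prefix-unique : ∀ {y x w} (p : Walk R y x) (w∈p : w ∈ vertices p) →
                  Unique (vertices p) → Unique (vertices (prefix p w∈p))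
  prefix-unique (here _)   (here refl) up       = up
  prefix-unique (step _ _) (here refl) _        = [] ∷ []
  prefix-unique (step _ p) (there w∈p) (y∉p ∷ up) = anti-mono (prefix-⊆ p w∈p) y∉p ∷ prefix-unique p w∈p up

module _ {n : ℕ} (R : Digraph n) where

  data SourceOrCycle (x : Fin n) : Set where
    source : ∀ {y} (p : Walk R y x) → Unique (vertices p) → (∀ z → R z y ≡ false) → SourceOrCycle x
    cycle  : ∀ {v w} → R w v ≡ true → (q : Walk R v w) → Unique (vertices q) → SourceOrCycle x

  sourceOrCycle : ∀ x → SourceOrCycle x
  sourceOrCycle x = search n (here x) ([] ∷ []) (+-comm n 1)
    where
    open import Data.List.Membership.DecPropositional (_≟ᶠ_ {n}) using (_∈?_)
    search : ∀ fuel {y} (p : Walk R y x) → Unique (vertices p) → fuel + length (vertices p) ≡ suc n →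
             SourceOrCycle x
    search zero p up len = ⊥-elim (≤⇒≯ (unique-length up) (≤-reflexive (sym len)))
    search (suc fuel) {y} p up len with any? (λ z → R z y ≟ᵇ true)
    ... | no none = source p up (λ z → ¬-not (λ zy → none (z , zy)))
    ... | yes (w , wy) with w ∈? vertices p
    ...   | yes w∈p = cycle wy (prefix p w∈p) (prefix-unique p w∈p up)
    ...   | no  w∉p = search fuel (step wy p) (¬Any⇒All¬ _ w∉p ∷ up) (trans (+-suc fuel _) len)

-- Unit flows and their decomposition into arc-disjoint paths

module _ {n : ℕ} where

  record IsFlow (D : Digraph n) (s t : Fin n) (k : ℕ) : Set where
    constructor conserving
    field conservation : ∀ x → outDeg D x + k * δ t x ≡ inDeg D x + k * δ s x
  open IsFlow

  module _ {D E : Digraph n} {s t : Fin n} {m k : ℕ} where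

    flow-∖ : E ⊆ᵈ D → IsFlow D s t (m + k) → IsFlow E s t m → IsFlow (D ∖ E) s t k
    flow-∖ E⊆D flowD flowE = conserving λ x → +-cancelʳ-≡ (outDeg E x + m * δ t x) _ _ (begin
      outDeg (D ∖ E) x + k * δ t x + (outDeg E x + m * δ t x)
        ≡⟨ regroup (outDeg (D ∖ E) x) (outDeg E x) k m (δ t x) ⟩
      outDeg (D ∖ E) x + outDeg E x + (m + k) * δ t x
        ≡⟨ cong (_+ (m + k) * δ t x) (outDeg-∖ {D = D} {E = E} E⊆D x) ⟩
      outDeg D x + (m + k) * δ t x
        ≡⟨ flowD .conservation x ⟩
      inDeg D x + (m + k) * δ s x
        ≡⟨ cong (_+ (m + k) * δ s x) (inDeg-∖ {D = D} {E = E} E⊆D x) ⟨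
      inDeg (D ∖ E) x + inDeg E x + (m + k) * δ s x
        ≡⟨ regroup (inDeg (D ∖ E) x) (inDeg E x) k m (δ s x) ⟨
      inDeg (D ∖ E) x + k * δ s x + (inDeg E x + m * δ s x)
        ≡⟨ cong (inDeg (D ∖ E) x + k * δ s x +_) (flowE .conservation x) ⟨
      inDeg (D ∖ E) x + k * δ s x + (outDeg E x + m * δ t x) ∎)
      where
      open ≡-Reasoning
      regroup : ∀ a e k m d → a + k * d + (e + m * d) ≡ a + e + (m + k) * d
      regroup = solve-∀

  module _ {R : Digraph n} where

    path-flow : ∀ {s t} (p : Walk R s t) → Unique (edges p) → IsFlow (arcsOf (edges p)) s t 1
    path-flow {s} {t} p up = conserving λ x → begin
      outDeg (arcsOf (edges p)) x + (δ t x + 0) ≡⟨ cong (outDeg (arcsOf (edges p)) x +_) (+-identityʳ (δ t x)) ⟩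
      outDeg (arcsOf (edges p)) x + δ t x       ≡⟨ walk-balance p up x ⟩
      inDeg (arcsOf (edges p)) x + δ s x        ≡⟨ cong (inDeg (arcsOf (edges p)) x +_) (+-identityʳ (δ s x)) ⟨
      inDeg (arcsOf (edges p)) x + (δ s x + 0)  ∎
      where open ≡-Reasoning

    cycle-flow : ∀ {w} (c : Walk R w w) → Unique (edges c) → ∀ {s t} → IsFlow (arcsOf (edges c)) s t 0
    cycle-flow {w} c uc = conserving λ x →
      trans (+-identityʳ _) (trans (+-cancelʳ-≡ (δ w x) _ _ (walk-balance c uc x)) (sym (+-identityʳ _)))

  record ArcDisjointPaths (D : Digraph n) (s t : Fin n) (k : ℕ) : Set where
    field
      path     : Fin k → Walk D s t
      simple   : ∀ i → Unique (vertices (path i))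
      disjoint : ∀ {i j} → i ≢ j → ∀ {e} → e ∈ edges (path i) → e ∈ edges (path j) → ⊥
  open ArcDisjointPaths

  mapPaths : ∀ {D D′ s t k} → D ⊆ᵈ D′ → ArcDisjointPaths D s t k → ArcDisjointPaths D′ s t k
  mapPaths D⊆D′ P .path i = mapWalk D⊆D′ (P .path i)
  mapPaths D⊆D′ P .simple i = subst Unique (sym (vertices-mapWalk D⊆D′ (P .path i))) (P .simple i)
  mapPaths D⊆D′ P .disjoint i≢j e∈i e∈j =
    P .disjoint i≢j (subst (_ ∈_) (edges-mapWalk D⊆D′ (P .path _)) e∈i)
                    (subst (_ ∈_) (edges-mapWalk D⊆D′ (P .path _)) e∈j)

  consPath : ∀ {D s t k} (p : Walk D s t) → Unique (vertices p) →
             ArcDisjointPaths (D ∖ arcsOf (edges p)) s t k → ArcDisjointPaths D s t (suc k)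
  consPath {D} p up P = record { path = paths ; simple = simples ; disjoint = disjoints }
    where
    D∖p⊆D : D ∖ arcsOf (edges p) ⊆ᵈ D
    D∖p⊆D = ∖-⊆ {D = D} {E = arcsOf (edges p)}
    P′ = mapPaths D∖p⊆D P
    paths : Fin _ → Walk D _ _
    paths zero    = p
    paths (suc i) = P′ .path i
    simples : ∀ i → Unique (vertices (paths i))
    simples zero    = up
    simples (suc i) = P′ .simple i
    avoids-p : ∀ i {e} → e ∈ edges (P′ .path i) → e ∉ edges p
    avoids-p i {_ , _} e∈i e∈p with ∈-edges⇒arc (P .path i) (subst (_ ∈_) (edges-mapWalk D∖p⊆D (P .path i)) e∈i)
    ... | arc = case trans (sym (arcsOf-∈ e∈p)) (∖-excludes {D = D} {E = arcsOf (edges p)} arc) of λ ()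
    disjoints : ∀ {i j} → i ≢ j → ∀ {e} → e ∈ edges (paths i) → e ∈ edges (paths j) → ⊥
    disjoints {zero}  {zero}  i≢j = ⊥-elim (i≢j refl)
    disjoints {zero}  {suc j} _ e∈p e∈j = avoids-p j e∈j e∈p
    disjoints {suc i} {zero}  _ e∈i e∈p = avoids-p i e∈i e∈p
    disjoints {suc i} {suc j} i≢j = P′ .disjoint (i≢j ∘ cong suc)

  loopPaths : ∀ {D s k} → ArcDisjointPaths D s s k
  loopPaths {s = s} = record { path = λ _ → here s ; simple = λ _ → [] ∷ [] ; disjoint = λ _ () }

  noPaths : ∀ {D s t} → ArcDisjointPaths D s t 0
  noPaths .path ()
  noPaths .simple ()
  noPaths .disjoint {()}

  module _ {s t : Fin n} (s≢t : s ≢ t) where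

    source-is-s : ∀ {D k y} → IsFlow D s t (suc k) → Walk D y t → (∀ z → D z y ≡ false) → y ≡ s
    source-is-s {D} {k} {y} flow p noIn with y ≟ᶠ s
    ... | yes y≡s = y≡s
    ... | no  y≢s = case ≤-trans (leaves p) (≤-reflexive (trans (flow .conservation y) nothing-enters)) of λ ()
      where
      leaves : ∀ {y} → Walk D y t → 1 ≤ outDeg D y + suc k * δ t y
      leaves (here _)   = ≤-trans (subst (λ d → 1 ≤ suc k * d) (sym (δ-self t)) (s≤s z≤n))
                                  (m≤n+m (suc k * δ t t) (outDeg D t))
      leaves (step e _) = ≤-trans (outDeg-pos {D = D} e) (m≤m+n _ _)
      nothing-enters : inDeg D y + suc k * δ s y ≡ 0
      nothing-enters = cong₂ _+_ (∑-χ-none noIn) (trans (cong (suc k *_) (δ-other y≢s)) (*-zeroʳ (suc k)))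

    path-has-arc : ∀ {R : Digraph n} (p : Walk R s t) → ∃[ v ] arcsOf (edges p) s v ≡ true
    path-has-arc (here _)   = ⊥-elim (s≢t refl)
    path-has-arc p@(step _ _) = _ , arcsOf-∈ {es = edges p} (here refl)

    decompose : ∀ m {D k} → arcCount D < m → IsFlow D s t k → ArcDisjointPaths D s t k
    decompose (suc m) {k = zero}  _    _    = noPaths
    decompose (suc m) {D} {suc k} size flow with sourceOrCycle D t
    ... | cycle e q uq = mapPaths (∖-⊆ {D = D} {E = C})
      (decompose m (fewer-arcs {D = D} {E = C} C⊆D size (arcsOf-∈ {es = edges c} (here refl)))
                   (flow-∖ C⊆D flow (cycle-flow c (unique-edges-cycle e q uq))))
      where
      c = step e q
      C = arcsOf (edges c)
      C⊆D : C ⊆ᵈ D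
      C⊆D = arcsOf-edges-⊆ c
    ... | source p up noIn with source-is-s flow p noIn
    ...   | refl = consPath p up
      (decompose m (fewer-arcs {D = D} {E = P} P⊆D size (proj₂ (path-has-arc p)))
                   (flow-∖ P⊆D flow (path-flow p (unique-edges p up))))
      where
      P = arcsOf (edges p)
      P⊆D : P ⊆ᵈ D
      P⊆D = arcsOf-edges-⊆ p

  flow-decomposition : ∀ {D s t k} → IsFlow D s t k → ArcDisjointPaths D s t k
  flow-decomposition {D} {s} {t} flow with s ≟ᶠ t
  ... | yes refl = loopPaths
  ... | no  s≢t  = decompose s≢t (suc (arcCount D)) (n<1+n _) flow

module _ {n k : ℕ} (E : Fin k → Digraph n) where

  ⋃ : Digraph n
  ⋃ u v = does (any? (λ i → E i u v ≟ᵇ true))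

  ⋃-elim : ∀ {u v} → ⋃ u v ≡ true → ∃[ i ] E i u v ≡ true
  ⋃-elim {u} {v} = witness (any? (λ i → E i u v ≟ᵇ true))

  module _ (disjoint : ∀ {i j u v} → E i u v ≡ true → E j u v ≡ true → i ≡ j) where

    χ-⋃ : ∀ u v → χ (⋃ u v) ≡ ∑[ i < k ] χ (E i u v)
    χ-⋃ u v = trans (∑-χ-any (λ i → E i u v ≟ᵇ true) (λ i j → disjoint)) (sum-cong-≗ (λ i → χ-≟-true (E i u v)))
      where
      χ-≟-true : ∀ b → χ (does (b ≟ᵇ true)) ≡ χ b
      χ-≟-true true  = refl
      χ-≟-true false = refl

    outDeg-⋃ : ∀ x → outDeg ⋃ x ≡ ∑[ i < k ] outDeg (E i) x
    outDeg-⋃ x = trans (sum-cong-≗ (χ-⋃ x)) (∑-comm (λ y i → χ (E i x y)))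

    inDeg-⋃ : ∀ x → inDeg ⋃ x ≡ ∑[ i < k ] inDeg (E i) x
    inDeg-⋃ x = trans (sum-cong-≗ (λ y → χ-⋃ y x)) (∑-comm (λ y i → χ (E i y x)))

    ⋃-flow : ∀ {s t} → (∀ i → IsFlow (E i) s t 1) → IsFlow ⋃ s t k
    ⋃-flow {s} {t} flows = conserving λ x → begin
      outDeg ⋃ x + k * δ t x                             ≡⟨ cong₂ _+_ (outDeg-⋃ x) (sym (∑-unit t x)) ⟩
      ∑[ i < k ] outDeg (E i) x + ∑[ i < k ] (1 * δ t x) ≡⟨ ∑-distrib-+ (λ i → outDeg (E i) x) _ ⟨
      ∑[ i < k ] (outDeg (E i) x + 1 * δ t x)           ≡⟨ sum-cong-≗ (λ i → flows i .IsFlow.conservation x) ⟩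
      ∑[ i < k ] (inDeg (E i) x + 1 * δ s x)            ≡⟨ ∑-distrib-+ (λ i → inDeg (E i) x) _ ⟩
      ∑[ i < k ] inDeg (E i) x + ∑[ i < k ] (1 * δ s x)  ≡⟨ cong₂ _+_ (sym (inDeg-⋃ x)) (∑-unit s x) ⟩
      inDeg ⋃ x + k * δ s x                              ∎
      where
      open ≡-Reasoning
      ∑-unit : ∀ a x → ∑[ i < k ] (1 * δ a x) ≡ k * δ a x
      ∑-unit a x = trans (∑-const k (1 * δ a x)) (cong (k *_) (*-identityˡ (δ a x)))

-- Topological numberings

module _ {n : ℕ} where

  Acyclic : Digraph n → Set
  Acyclic D = ∀ {v w} → D w v ≡ true → (q : Walk D v w) → Unique (vertices q) → ⊥

  _↾_ : Digraph n → (Fin n → Bool) → Digraph n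
  (D ↾ V) u v = V u ∧ V v ∧ D u v

  ↾-⊆ : ∀ {D V} → D ↾ V ⊆ᵈ D
  ↾-⊆ {D} {V} {u} {v} uv with V u | V v
  ... | true | true = uv

  ↾-tail : ∀ {D V u v} → (D ↾ V) u v ≡ true → V u ≡ true
  ↾-tail {D} {V} {u} uv with V u
  ... | true = refl

  ↾-intro : ∀ {D V u v} → V u ≡ true → V v ≡ true → D u v ≡ true → (D ↾ V) u v ≡ true
  ↾-intro Vu Vv uv rewrite Vu | Vv = uv

  _∖ᵛ_ : (Fin n → Bool) → Fin n → Fin n → Bool
  (V ∖ᵛ y) v = V v ∧ not (does (v ≟ᶠ y))

  ∖ᵛ-intro : ∀ {V y v} → V v ≡ true → v ≢ y → (V ∖ᵛ y) v ≡ true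
  ∖ᵛ-intro {V} {y} {v} Vv v≢y rewrite Vv | dec-false (v ≟ᶠ y) v≢y = refl

  ∑-χ-∖ᵛ : ∀ {V y} → V y ≡ true → ∑[ v < n ] χ ((V ∖ᵛ y) v) + 1 ≡ ∑[ v < n ] χ (V v)
  ∑-χ-∖ᵛ {V} {y} Vy = begin
    ∑[ v < n ] χ ((V ∖ᵛ y) v) + 1                ≡⟨ cong (∑[ v < n ] χ ((V ∖ᵛ y) v) +_) (∑-δ y) ⟨
    ∑[ v < n ] χ ((V ∖ᵛ y) v) + ∑[ v < n ] δ y v ≡⟨ ∑-distrib-+ (χ ∘ (V ∖ᵛ y)) (δ y) ⟨
    ∑[ v < n ] (χ ((V ∖ᵛ y) v) + δ y v)          ≡⟨ sum-cong-≗ (λ v → χ-∖ (V v) _ (V-at v)) ⟩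
    ∑[ v < n ] χ (V v)                           ∎
    where
    open ≡-Reasoning
    V-at : ∀ v → does (v ≟ᶠ y) ≡ true → V v ≡ true
    V-at v v≡y rewrite witness (v ≟ᶠ y) v≡y = Vy

  record Numbering (D : Digraph n) (V : Fin n → Bool) (c : ℕ) : Set where
    field
      pos        : Fin n → ℕ
      bounded    : ∀ {v} → V v ≡ true → pos v < c
      injective  : ∀ {u v} → V u ≡ true → V v ≡ true → pos u ≡ pos v → u ≡ v
      increasing : ∀ {u v} → V u ≡ true → V v ≡ true → D u v ≡ true → pos u < pos v
  open Numbering

  emptyNumbering : ∀ {D V} → (∀ {v} → V v ≡ true → ⊥) → Numbering D V 0
  emptyNumbering empty = record
    { pos = λ _ → 0 ; bounded = ⊥-elim ∘ empty ; injective = λ Vu _ _ → ⊥-elim (empty Vu)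
    ; increasing = λ Vu _ _ → ⊥-elim (empty Vu) }

  module _ {D : Digraph n} {V : Fin n → Bool} {c : ℕ} {y : Fin n}
           (source : ∀ {u} → (D ↾ V) u y ≡ false) (N : Numbering D (V ∖ᵛ y) c) where

    prependSource : Numbering D V (suc c)
    prependSource = record
      { pos = pos′ ; bounded = bounded′ ; injective = injective′ ; increasing = increasing′ }
      where
      pos′ : Fin n → ℕ
      pos′ v with v ≟ᶠ y
      ... | yes _ = 0
      ... | no  _ = suc (N .pos v)
      bounded′ : ∀ {v} → V v ≡ true → pos′ v < suc c
      bounded′ {v} Vv with v ≟ᶠ y
      ... | yes _   = s≤s z≤n
      ... | no  v≢y = s≤s (N .bounded (∖ᵛ-intro {V = V} Vv v≢y))
      injective′ : ∀ {u v} → V u ≡ true → V v ≡ true → pos′ u ≡ pos′ v → u ≡ v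
      injective′ {u} {v} Vu Vv eq with u ≟ᶠ y | v ≟ᶠ y
      ... | yes refl | yes refl = refl
      ... | no  u≢y  | no  v≢y  =
        N .injective (∖ᵛ-intro {V = V} Vu u≢y) (∖ᵛ-intro {V = V} Vv v≢y) (suc-injective eq)
      increasing′ : ∀ {u v} → V u ≡ true → V v ≡ true → D u v ≡ true → pos′ u < pos′ v
      increasing′ {u} {v} Vu Vv uv with v ≟ᶠ y | u ≟ᶠ y
      ... | yes refl | _       = case trans (sym source) (↾-intro {D = D} Vu Vv uv) of λ ()
      ... | no  _    | yes _   = s≤s z≤n
      ... | no  v≢y  | no  u≢y = s≤s (N .increasing (∖ᵛ-intro {V = V} Vu u≢y) (∖ᵛ-intro {V = V} Vv v≢y) uv)

  module _ {D : Digraph n} (acyclic : Acyclic D) where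

    numbering : ∀ c (V : Fin n → Bool) → ∑[ v < n ] χ (V v) ≡ c → Numbering D V c
    numbering zero V size = emptyNumbering (λ {v} Vv → case ≤-trans (≤-reflexive (cong χ (sym Vv)))
                                                      (≤-trans (≤-∑ (χ ∘ V) v) (≤-reflexive size)) of λ ())
    numbering (suc c) V size with any? (λ v → V v ≟ᵇ true)
    ... | no none = case trans (sym (∑-χ-none (λ v → ¬-not (λ Vv → none (v , Vv))))) size of λ ()
    ... | yes (x , Vx) with sourceOrCycle (D ↾ V) x
    ...   | cycle e q uq =
      ⊥-elim (acyclic (↾-⊆′ e) (mapWalk ↾-⊆′ q) (subst Unique (sym (vertices-mapWalk ↾-⊆′ q)) uq))
      where ↾-⊆′ = ↾-⊆ {D = D} {V = V}
    ...   | source {y} p _ noIn =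
      prependSource (noIn _)
        (numbering c (V ∖ᵛ y) (suc-injective (trans (+-comm 1 _) (trans (∑-χ-∖ᵛ Vy) size))))
      where
      start-in-V : ∀ {y} → Walk (D ↾ V) y x → V y ≡ true
      start-in-V (here _)   = Vx
      start-in-V (step e _) = ↾-tail {D = D} {V = V} e
      Vy = start-in-V p

-- Counting arcs by their lengths

module _ {a b : ℕ} where

  ∑₂ : (Fin a → Fin b → ℕ) → ℕ
  ∑₂ w = ∑[ u < a ] ∑[ v < b ] w u v

  ∑₂-cong : ∀ {w w′ : Fin a → Fin b → ℕ} → (∀ u v → w u v ≡ w′ u v) → ∑₂ w ≡ ∑₂ w′
  ∑₂-cong w≗w′ = sum-cong-≗ (λ u → sum-cong-≗ (w≗w′ u))

  ∑₂-distrib-+ : ∀ (w w′ : Fin a → Fin b → ℕ) → ∑₂ (λ u v → w u v + w′ u v) ≡ ∑₂ w + ∑₂ w′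
  ∑₂-distrib-+ w w′ = trans (sum-cong-≗ (λ u → ∑-distrib-+ (w u) (w′ u)))
                             (∑-distrib-+ (λ u → ∑[ v < b ] w u v) (λ u → ∑[ v < b ] w′ u v))

  ∑₂-zero : ∑₂ (λ _ _ → 0) ≡ 0
  ∑₂-zero = trans (sum-cong-≗ {a} {λ _ → ∑[ v < b ] 0} {λ _ → 0} (λ _ → ∑-zero b)) (∑-zero a)

  ≤-∑₂ : ∀ (w : Fin a → Fin b → ℕ) u v → w u v ≤ ∑₂ w
  ≤-∑₂ w u v = ≤-trans (≤-∑ (w u) v) (≤-∑ (λ u → ∑[ v < b ] w u v) u)

sgn : ℕ → ℕ
sgn zero    = 0
sgn (suc _) = 1

sgn-pos : ∀ {m} → 0 < m → sgn m ≡ 1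
sgn-pos {suc _} _ = refl

module _ {a b : ℕ} where

  support : (Fin a → Fin b → ℕ) → ℕ
  support w = ∑₂ (λ u v → sgn (w u v))

  multiplicity : (Fin a → Fin b → ℕ) → ℕ → ℕ
  multiplicity w ℓ = ∑₂ (λ u v → χ (w u v ≡ᵇ ℓ))

  private
    square-step : ∀ N c m S → c ≤ N → m * m ≤ 2 * N * S → (c + m) * (c + m) ≤ 2 * N * (c + m + S)
    square-step N c m S c≤N m²≤ = begin
      (c + m) * (c + m)                  ≡⟨ expand c m ⟩
      c * c + 2 * c * m + m * m
        ≤⟨ +-mono-≤ (+-mono-≤ (*-monoˡ-≤ c c≤N) (*-monoˡ-≤ m (*-monoʳ-≤ 2 c≤N))) m²≤ ⟩
      N * c + 2 * N * m + 2 * N * S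
        ≤⟨ +-monoˡ-≤ (2 * N * S) (+-monoˡ-≤ (2 * N * m) (*-monoˡ-≤ c (m≤n*m N 2))) ⟩
      2 * N * c + 2 * N * m + 2 * N * S  ≡⟨ collect N c m S ⟩
      2 * N * (c + m + S)                ∎
      where
      open ≤-Reasoning
      expand : ∀ c m → (c + m) * (c + m) ≡ c * c + 2 * c * m + m * m
      expand = solve-∀
      collect : ∀ N c m S → 2 * N * c + 2 * N * m + 2 * N * S ≡ 2 * N * (c + m + S)
      collect = solve-∀

  support-squared-≤ : ∀ N (w : Fin a → Fin b → ℕ) → (∀ ℓ → multiplicity w (suc ℓ) ≤ N) →
                      support w * support w ≤ 2 * N * ∑₂ w
  support-squared-≤ N w mult = go (∑₂ w) w (≤-∑₂ w) mult
    where
    go : ∀ f w → (∀ u v → w u v ≤ f) → (∀ ℓ → multiplicity w (suc ℓ) ≤ N) →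
         support w * support w ≤ 2 * N * ∑₂ w
    go zero w w≤0 _ = subst (λ σ → σ * σ ≤ 2 * N * ∑₂ w) (sym no-support) z≤n
      where
      no-support : support w ≡ 0
      no-support = trans (∑₂-cong (λ u v → cong sgn (n≤0⇒n≡0 (w≤0 u v)))) (∑₂-zero {a} {b})
    go (suc f) w w≤ mult = begin
      support w * support w             ≡⟨ cong (λ σ → σ * σ) support-split ⟩
      (c + support w′) * (c + support w′) ≤⟨ square-step N c _ _ (mult 0) (go f w′ w′≤ mult′) ⟩
      2 * N * (c + support w′ + ∑₂ w′)  ≡⟨ cong (λ σ → 2 * N * (σ + ∑₂ w′)) support-split ⟨
      2 * N * (support w + ∑₂ w′)       ≡⟨ cong (2 * N *_) total-split ⟨
      2 * N * ∑₂ w                      ∎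
      where
      open ≤-Reasoning
      w′ : Fin a → Fin b → ℕ
      w′ u v = w u v ∸ 1
      c = multiplicity w 1
      w′≤ : ∀ u v → w′ u v ≤ f
      w′≤ u v = ∸-monoˡ-≤ 1 (w≤ u v)
      mult′ : ∀ ℓ → multiplicity w′ (suc ℓ) ≤ N
      mult′ ℓ = ≤-trans (≤-reflexive (∑₂-cong (λ u v → shift (w u v)))) (mult (suc ℓ))
        where
        shift : ∀ m → χ (m ∸ 1 ≡ᵇ suc ℓ) ≡ χ (m ≡ᵇ suc (suc ℓ))
        shift zero    = refl
        shift (suc m) = refl
      support-split : support w ≡ c + support w′
      support-split = trans (∑₂-cong (λ u v → split (w u v)))
                            (∑₂-distrib-+ (λ u v → χ (w u v ≡ᵇ 1)) (λ u v → sgn (w′ u v)))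
        where
        split : ∀ m → sgn m ≡ χ (m ≡ᵇ 1) + sgn (m ∸ 1)
        split zero          = refl
        split (suc zero)    = refl
        split (suc (suc m)) = refl
      total-split : ∑₂ w ≡ support w + ∑₂ w′
      total-split = trans (∑₂-cong (λ u v → split (w u v))) (∑₂-distrib-+ (λ u v → sgn (w u v)) w′)
        where
        split : ∀ m → m ≡ sgn m + (m ∸ 1)
        split zero    = refl
        split (suc m) = refl

module _ {n : ℕ} {D : Digraph n} {s t : Fin n} {k : ℕ} (flow : IsFlow D s t k)
         (pos : Fin n → ℕ) (monotone : ∀ {u v} → D u v ≡ true → pos u ≤ pos v) where

  arcLength : Fin n → Fin n → ℕ
  arcLength u v = χ (D u v) * (pos v ∸ pos u)

  ∑-arcLength : ∑₂ arcLength + k * pos s ≡ k * pos t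
  ∑-arcLength = +-cancelˡ-≡ (∑₂ tailPos) _ _ (begin
    ∑₂ tailPos + (∑₂ arcLength + k * pos s)        ≡⟨ +-assoc (∑₂ tailPos) _ _ ⟨
    ∑₂ tailPos + ∑₂ arcLength + k * pos s          ≡⟨ cong (_+ k * pos s) heads-split ⟨
    ∑₂ headPos + k * pos s                         ≡⟨ cong (_+ k * pos s) ∑₂-headPos ⟩
    ∑[ x < n ] (pos x * inDeg D x) + k * pos s     ≡⟨ weighted (inDeg D) s ⟨
    ∑[ x < n ] (pos x * (inDeg D x + k * δ s x))   ≡⟨ sum-cong-≗ (λ x → cong (pos x *_) (flow .conservation x)) ⟨
    ∑[ x < n ] (pos x * (outDeg D x + k * δ t x))  ≡⟨ weighted (outDeg D) t ⟩
    ∑[ x < n ] (pos x * outDeg D x) + k * pos t    ≡⟨ cong (_+ k * pos t) ∑₂-tailPos ⟨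
    ∑₂ tailPos + k * pos t                         ∎)
    where
    open ≡-Reasoning
    open IsFlow
    tailPos headPos : Fin n → Fin n → ℕ
    tailPos u v = χ (D u v) * pos u
    headPos u v = χ (D u v) * pos v

    heads-split : ∑₂ headPos ≡ ∑₂ tailPos + ∑₂ arcLength
    heads-split = trans (∑₂-cong split) (∑₂-distrib-+ tailPos arcLength)
      where
      split : ∀ u v → headPos u v ≡ tailPos u v + arcLength u v
      split u v with D u v in uv
      ... | true  = begin
        pos v + 0                         ≡⟨ +-identityʳ (pos v) ⟩
        pos v                             ≡⟨ m+[n∸m]≡n (monotone uv) ⟨
        pos u + (pos v ∸ pos u)           ≡⟨ cong₂ _+_ (+-identityʳ (pos u)) (+-identityʳ _) ⟨
        pos u + 0 + (pos v ∸ pos u + 0)   ∎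
      ... | false = refl

    out-weighted : ∀ x → ∑[ v < n ] (χ (D x v) * pos x) ≡ pos x * outDeg D x
    out-weighted x = trans (sum-cong-≗ (λ v → *-comm (χ (D x v)) (pos x)))
                           (sym (*-distribˡ-sum (pos x) (χ ∘ D x)))

    ∑₂-tailPos : ∑₂ tailPos ≡ ∑[ x < n ] (pos x * outDeg D x)
    ∑₂-tailPos = sum-cong-≗ out-weighted

    ∑₂-headPos : ∑₂ headPos ≡ ∑[ x < n ] (pos x * inDeg D x)
    ∑₂-headPos = trans (∑-comm headPos) (sum-cong-≗ (λ x →
      trans (sum-cong-≗ (λ u → *-comm (χ (D u x)) (pos x))) (sym (*-distribˡ-sum (pos x) (λ u → χ (D u x))))))

    weighted : ∀ (f : Fin n → ℕ) a →
               ∑[ x < n ] (pos x * (f x + k * δ a x)) ≡ ∑[ x < n ] (pos x * f x) + k * pos a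
    weighted f a = begin
      ∑[ x < n ] (pos x * (f x + k * δ a x))             ≡⟨ sum-cong-≗ (λ x → *-distribˡ-+ (pos x) (f x) _) ⟩
      ∑[ x < n ] (pos x * f x + pos x * (k * δ a x))     ≡⟨ ∑-distrib-+ (λ x → pos x * f x) _ ⟩
      ∑[ x < n ] (pos x * f x) + ∑[ x < n ] (pos x * (k * δ a x))
        ≡⟨ cong (∑[ x < n ] (pos x * f x) +_) (sum-cong-≗ (λ x → rearrange (pos x) k (δ a x))) ⟩
      ∑[ x < n ] (pos x * f x) + ∑[ x < n ] (δ a x * (k * pos x))
        ≡⟨ cong (∑[ x < n ] (pos x * f x) +_) (∑-δ-* a (λ x → k * pos x)) ⟩
      ∑[ x < n ] (pos x * f x) + k * pos a               ∎
      where
      rearrange : ∀ p k d → p * (k * d) ≡ d * (k * p)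
      rearrange = solve-∀

module _ {n : ℕ} {D : Digraph n} {s t : Fin n} {k : ℕ} where

  acyclic-flow-arcCount : IsFlow D s t k → Acyclic D → arcCount D * arcCount D ≤ 2 * k * (n * n)
  acyclic-flow-arcCount flow acyclic = begin
    arcCount D * arcCount D  ≡⟨ cong (λ m → m * m) support≡arcCount ⟨
    support w * support w    ≤⟨ support-squared-≤ n w multiplicity≤n ⟩
    2 * n * ∑₂ w             ≤⟨ *-monoʳ-≤ (2 * n) ∑₂w≤kn ⟩
    2 * n * (k * n)          ≡⟨ rearrange n k ⟩
    2 * k * (n * n)          ∎
    where
    open ≤-Reasoning
    open Numbering (numbering acyclic n (λ _ → true) (trans (∑-const n 1) (*-identityʳ n)))
    w : Fin n → Fin n → ℕ
    w = arcLength flow pos (<⇒≤ ∘ increasing refl refl)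

    support≡arcCount : support w ≡ arcCount D
    support≡arcCount = ∑₂-cong sgn-w
      where
      sgn-w : ∀ u v → sgn (w u v) ≡ χ (D u v)
      sgn-w u v with D u v in uv
      ... | false = refl
      ... | true = trans (cong sgn (+-identityʳ (pos v ∸ pos u)))
                         (sgn-pos (m<n⇒0<n∸m (increasing refl refl uv)))

    arc-of-length : ∀ {u v ℓ} → w u v ≡ suc ℓ → D u v ≡ true × pos v ∸ pos u ≡ suc ℓ
    arc-of-length {u} {v} wuv with D u v
    ... | true = refl , trans (sym (+-identityʳ _)) wuv

    multiplicity≤n : ∀ ℓ → multiplicity w (suc ℓ) ≤ n
    multiplicity≤n ℓ = begin
      multiplicity w (suc ℓ)  ≤⟨ ∑-mono-≤ (λ u → ∑-χ-≤1 (λ v v′ → same-length u v v′)) ⟩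
      ∑[ u < n ] 1            ≡⟨ ∑-const n 1 ⟩
      n * 1                   ≡⟨ *-identityʳ n ⟩
      n                       ∎
      where
      same-length : ∀ u v v′ → (w u v ≡ᵇ suc ℓ) ≡ true → (w u v′ ≡ᵇ suc ℓ) ≡ true → v ≡ v′
      same-length u v v′ h h′
        with arc-of-length {u} {v} (≡ᵇ⇒≡ _ _ (subst T (sym h) tt))
           | arc-of-length {u} {v′} (≡ᵇ⇒≡ _ _ (subst T (sym h′) tt))
      ... | uv , len | uv′ , len′ =
        injective refl refl (∸-cancelʳ-≡ (<⇒≤ (increasing refl refl uv)) (<⇒≤ (increasing refl refl uv′))
                                         (trans len (sym len′)))

    ∑₂w≤kn : ∑₂ w ≤ k * n
    ∑₂w≤kn = begin
      ∑₂ w               ≤⟨ m≤m+n (∑₂ w) (k * pos s) ⟩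
      ∑₂ w + k * pos s   ≡⟨ ∑-arcLength flow pos (<⇒≤ ∘ increasing refl refl) ⟩
      k * pos t          ≤⟨ *-monoʳ-≤ k (<⇒≤ (bounded refl)) ⟩
      k * n              ∎

    rearrange : ∀ n k → 2 * n * (k * n) ≡ 2 * k * (n * n)
    rearrange = solve-∀

countTrue-tabulate : ∀ {A : Set} {m} (p : A → Bool) (f : Fin m → A) →
                     countTrue p (tabulate f) ≡ ∑[ i < m ] χ (p (f i))
countTrue-tabulate {m = zero}  p f = refl
countTrue-tabulate {m = suc m} p f with p (f zero)
... | true  = cong suc (countTrue-tabulate p (f ∘ suc))
... | false = countTrue-tabulate p (f ∘ suc)

sum-map-tabulate : ∀ {A : Set} {m} (g : A → ℕ) (f : Fin m → A) → sum (map g (tabulate f)) ≡ ∑[ i < m ] g (f i)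
sum-map-tabulate {m = zero}  g f = refl
sum-map-tabulate {m = suc m} g f = cong (g (f zero) +_) (sum-map-tabulate g (f ∘ suc))

numEdges-∑₂ : ∀ {κ n} (G : SimpleGraph κ n) → numEdges G ≡ ∑₂ (λ u v → χ (edgeIndicator κ (adj G) u v))
numEdges-∑₂ {κ} {n} G = trans (sum-map-tabulate (λ u → countTrue (edgeIndicator κ (adj G) u) (allFin n)) id)
                              (sum-cong-≗ (λ u → countTrue-tabulate (edgeIndicator κ (adj G) u) id))

module _ {n : ℕ} where

  χ-edgeIndicator : ∀ (a : Digraph n) u v → χ (edgeIndicator undirected a u v) ≡ χ (below u v) * χ (a u v)
  χ-edgeIndicator a u v with below u v
  ... | true  = sym (+-identityʳ (χ (a u v)))
  ... | false = refl

  χ-below : ∀ {u v : Fin n} → u ≢ v → χ (below u v) + χ (below v u) ≡ 1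
  χ-below {u} {v} u≢v with u <ᶠ? v | v <ᶠ? u
  ... | yes u<v | yes v<u = ⊥-elim (<-asym u<v v<u)
  ... | yes _   | no  _   = refl
  ... | no  _   | yes _   = refl
  ... | no  u≮v | no  v≮u = ⊥-elim (u≢v (toℕ-injective (≤-antisym (≮⇒≥ v≮u) (≮⇒≥ u≮v))))

underlying : ∀ {n} → Kind → Digraph n → Digraph n
underlying directed   D     = D
underlying undirected D u v = D u v ∨ D v u

AntiparallelFree : ∀ {n} → Digraph n → Set
AntiparallelFree D = ∀ {u v} → D u v ≡ true → D v u ≡ true → ⊥

numEdges-orientation : ∀ {κ n} (G : SimpleGraph κ n) (D : Digraph n) →
                       (∀ u v → adj G u v ≡ underlying κ D u v) → (κ ≡ undirected → AntiparallelFree D) →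
                       numEdges G ≡ arcCount D
numEdges-orientation {directed} G D adj≡ _ = trans (numEdges-∑₂ G) (∑₂-cong (λ u v → cong χ (adj≡ u v)))
numEdges-orientation {undirected} {n} G D adj≡ antiparallel = begin
  numEdges G                                                    ≡⟨ numEdges-∑₂ G ⟩
  ∑₂ (λ u v → χ (edgeIndicator undirected (adj G) u v))          ≡⟨ ∑₂-cong edge-arcs ⟩
  ∑₂ (λ u v → b u v * χ (D u v) + b u v * χ (D v u))           ≡⟨ ∑₂-distrib-+ (λ u v → b u v * χ (D u v)) _ ⟩
  ∑₂ (λ u v → b u v * χ (D u v)) + ∑₂ (λ u v → b u v * χ (D v u)) ≡⟨ cong (∑₂ (λ u v → b u v * χ (D u v)) +_)
                                                                       (∑-comm (λ u v → b u v * χ (D v u))) ⟩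
  ∑₂ (λ u v → b u v * χ (D u v)) + ∑₂ (λ u v → b v u * χ (D u v)) ≡⟨ ∑₂-distrib-+ (λ u v → b u v * χ (D u v)) _ ⟨
  ∑₂ (λ u v → b u v * χ (D u v) + b v u * χ (D u v))           ≡⟨ ∑₂-cong arc-once ⟩
  arcCount D                                                    ∎
  where
  open ≡-Reasoning
  b : Fin n → Fin n → ℕ
  b u v = χ (below u v)
  edge-arcs : ∀ u v → χ (edgeIndicator undirected (adj G) u v) ≡ b u v * χ (D u v) + b u v * χ (D v u)
  edge-arcs u v = begin
    χ (edgeIndicator undirected (adj G) u v) ≡⟨ χ-edgeIndicator (adj G) u v ⟩
    b u v * χ (adj G u v)                    ≡⟨ cong (λ a → b u v * χ a) (adj≡ u v) ⟩
    b u v * χ (D u v ∨ D v u)                ≡⟨ cong (b u v *_) (χ-∨ (D u v) (D v u) (antiparallel refl)) ⟩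
    b u v * (χ (D u v) + χ (D v u))          ≡⟨ *-distribˡ-+ (b u v) _ _ ⟩
    b u v * χ (D u v) + b u v * χ (D v u)    ∎
  arc-once : ∀ u v → b u v * χ (D u v) + b v u * χ (D u v) ≡ χ (D u v)
  arc-once u v with D u v in uv
  ... | false = cong₂ _+_ (*-zeroʳ (b u v)) (*-zeroʳ (b v u))
  ... | true  = trans (sym (*-distribʳ-+ 1 (b u v) (b v u))) (cong (_* 1) (χ-below u≢v))
    where
    u≢v : u ≢ v
    u≢v refl = case trans (sym (loopless G u)) (trans (adj≡ u u) (cong (_∨ D u u) uv)) of λ ()

module _ {n : ℕ} where

  sameEdge-refl : ∀ κ {e : Arc n} → SameEdge κ e e
  sameEdge-refl directed   = refl , refl
  sameEdge-refl undirected = inj₁ (refl , refl)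

  sameEdge-cases : ∀ κ {e f : Arc n} → SameEdge κ e f → e ≡ f ⊎ (κ ≡ undirected × f ≡ (proj₂ e , proj₁ e))
  sameEdge-cases directed   (refl , refl)        = inj₁ refl
  sameEdge-cases undirected (inj₁ (refl , refl)) = inj₁ refl
  sameEdge-cases undirected (inj₂ (refl , refl)) = inj₂ (refl , refl)

  ⊆-underlying : ∀ κ {D : Digraph n} → D ⊆ᵈ underlying κ D
  ⊆-underlying directed   uv = uv
  ⊆-underlying undirected uv rewrite uv = refl

  underlying-⊆ : ∀ {κ} (G : SimpleGraph κ n) {D} → D ⊆ᵈ adj G → underlying κ D ⊆ᵈ adj G
  underlying-⊆ {directed}   G D⊆G uv = D⊆G uv
  underlying-⊆ {undirected} G {D} D⊆G {u} {v} uv with D u v in D-uv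
  ... | true  = D⊆G D-uv
  ... | false = trans (symm G refl u v) (D⊆G uv)

  underlying-symmetric : ∀ κ (D : Digraph n) → κ ≡ undirected → ∀ u v → underlying κ D u v ≡ underlying κ D v u
  underlying-symmetric undirected D refl u v = ∨-comm (D u v) (D v u)

  underlying-false : ∀ κ {D : Digraph n} {u v} → D u v ≡ false → (κ ≡ undirected → D v u ≡ false) →
                     underlying κ D u v ≡ false
  underlying-false directed   uv _  = uv
  underlying-false undirected uv vu rewrite uv | vu refl = refl

-- Minimally k-st-edge-connected graphs

module MinimalGraph {κ : Kind} {n : ℕ} {G : SimpleGraph κ n} {s t : Fin n} {k : ℕ}
  (paths : HasDisjointPaths κ (λ _ → true) (adj G) s t k)
  (minimal : ∀ (H : Subgraph G) → Proper H → ¬ HasDisjointPaths κ (W H) (F H) s t k) where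

  P : Fin k → Walk (adj G) s t
  P i = walk (proj₁ paths i)

  arcsOfP : Fin k → Digraph n
  arcsOfP i = arcsOf (edges (P i))

  D : Digraph n
  D = ⋃ arcsOfP

  D⊆G : D ⊆ᵈ adj G
  D⊆G uv with ⋃-elim arcsOfP uv
  ... | i , uv∈P = arcsOf-edges-⊆ (P i) uv∈P

  open ArcDisjointPaths

  simple-P : ∀ i → Unique (vertices (P i))
  simple-P i = distinct (proj₁ paths i)

  arc-in-one-path : ∀ {i j u v} → arcsOfP i u v ≡ true → arcsOfP j u v ≡ true → i ≡ j
  arc-in-one-path {i} {j} uv∈i uv∈j with i ≟ᶠ j
  ... | yes i≡j = i≡j
  ... | no  i≢j = ⊥-elim (proj₂ paths i j i≢j (∈-arcsOf uv∈i) (∈-arcsOf uv∈j) (sameEdge-refl κ))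

  D-flow : IsFlow D s t k
  D-flow = ⋃-flow arcsOfP arc-in-one-path (λ i → path-flow (P i) (unique-edges (P i) (simple-P i)))

  D-antiparallel-free : κ ≡ undirected → AntiparallelFree D
  D-antiparallel-free und uv vu with ⋃-elim arcsOfP uv | ⋃-elim arcsOfP vu
  ... | i , uv∈i | j , vu∈j with i ≟ᶠ j
  ...   | yes refl = no-antiparallel (P i) (simple-P i) (∈-arcsOf uv∈i) (∈-arcsOf vu∈j)
  ...   | no  i≢j  = proj₂ paths i j i≢j (∈-arcsOf uv∈i) (∈-arcsOf vu∈j)
                       (subst (λ κ → SameEdge κ _ _) (sym und) (inj₂ (refl , refl)))

  graph-paths : ∀ {D′} → D′ ⊆ᵈ D → ArcDisjointPaths D′ s t k →
                HasDisjointPaths κ (λ _ → true) (underlying κ D′) s t k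
  graph-paths {D′} D′⊆D Q = path′ , disjoint′
    where
    lift : D′ ⊆ᵈ underlying κ D′
    lift = ⊆-underlying κ {D′}
    path′ : Fin k → Path (λ _ → true) (underlying κ D′) s t
    path′ i = record
      { walk     = mapWalk lift (Q .path i)
      ; distinct = subst Unique (sym (vertices-mapWalk lift (Q .path i))) (Q .simple i)
      ; inside   = All.universal (λ _ → refl) _ }
    unlift : ∀ i {e} → e ∈ edges (walk (path′ i)) → e ∈ edges (Q .path i)
    unlift i = subst (_ ∈_) (edges-mapWalk lift (Q .path i))
    disjoint′ : ∀ i j → i ≢ j → EdgeDisjoint κ (edges (walk (path′ i))) (edges (walk (path′ j)))
    disjoint′ i j i≢j e∈i f∈j same with sameEdge-cases κ same
    ... | inj₁ refl = Q .disjoint i≢j (unlift i e∈i) (unlift j f∈j)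
    ... | inj₂ (und , refl) = D-antiparallel-free und (D′⊆D (∈-edges⇒arc (Q .path i) (unlift i e∈i)))
                                                      (D′⊆D (∈-edges⇒arc (Q .path j) (unlift j f∈j)))

  covered : ∀ {D′} → D′ ⊆ᵈ D → IsFlow D′ s t k → ∀ {u v} → adj G u v ≡ true → underlying κ D′ u v ≡ true
  covered {D′} D′⊆D flow {u} {v} uv with underlying κ D′ u v in missing
  ... | true  = refl
  ... | false = ⊥-elim (minimal H (inj₂ (u , v , uv , missing)) (graph-paths D′⊆D (flow-decomposition flow)))
    where
    H : Subgraph G
    H = record
      { W = λ _ → true ; F = underlying κ D′ ; F⊆E = λ _ _ → underlying-⊆ G (λ h → D⊆G (D′⊆D h))
      ; F⊆W×W = λ _ _ _ → refl , refl ; Fsymm = underlying-symmetric κ D′ }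

  adj≡underlying : ∀ u v → adj G u v ≡ underlying κ D u v
  adj≡underlying u v with adj G u v in uv
  ... | true  = sym (covered (λ h → h) D-flow uv)
  ... | false = sym (¬-not (λ h → case trans (sym uv) (underlying-⊆ G D⊆G h) of λ ()))

  D-acyclic : Acyclic D
  D-acyclic {v} {w} wv q uq = case trans (sym (covered (∖-⊆ {D = D} {E = C}) flow′ (D⊆G wv))) removed of λ ()
    where
    c = step wv q
    C : Digraph n
    C = arcsOf (edges c)
    flow′ : IsFlow (D ∖ C) s t k
    flow′ = flow-∖ (arcsOf-edges-⊆ c) D-flow (cycle-flow c (unique-edges-cycle wv q uq))
    removed : underlying κ (D ∖ C) w v ≡ false
    removed = underlying-false κ (∖-removes {D = D} {E = C} (arcsOf-∈ {es = edges c} (here refl)))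
                (λ und → ¬-not (λ vw → D-antiparallel-free und wv (∖-⊆ {D = D} {E = C} vw)))

  numEdges≡arcCount : numEdges G ≡ arcCount D
  numEdges≡arcCount = numEdges-orientation G D adj≡underlying D-antiparallel-free

corollary1 : (κ : Kind) (n : ℕ) (G : SimpleGraph κ n) (s t : Fin n) (k : ℕ) →
    1 ≤ k → MinimallyEdgeConnected G s t k →
    numEdges G * numEdges G ≤ 2 * k * (n * n)
corollary1 κ n G s t k _ (paths , minimal) = begin
  numEdges G * numEdges G  ≡⟨ cong (λ m → m * m) numEdges≡arcCount ⟩
  arcCount D * arcCount D  ≤⟨ acyclic-flow-arcCount D-flow D-acyclic ⟩
  2 * k * (n * n)          ∎
  where
  open MinimalGraph paths minimal
  open ≤-Reasoning
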